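{- Let $N$ be a set of $\mathrm{BS}(\mathrm{LRA})$ clauses, let $S$ be a set of predicates that are positively grounded in $N$, and let $\mathcal{A}$ be an interpretation satisfying the clause set $\mathrm{elim}(S,N)$. Define the interpretation $\mathcal{A}'$ by $P^{\mathcal{A}'} = \{\bar a \in \mathbb{R}^n \mid P(\bar a) \text{ is a fact in } N\}$ for every $n$-ary $P \in S$, and $P^{\mathcal{A}'} = P^{\mathcal{A}}$ for every free predicate $P \notin S$. Then $\mathcal{A}'$ satisfies $N$.
   Context: $\mathrm{BS}(\mathrm{LRA})$ is a one-sorted first-order language whose only sort is interpreted as $\mathbb{R}$ and which has no non-constant function symbols other than arithmetic ones. Arithmetic terms are built from variables, first-order (free) constants, integer constants and binary $+$, $-$. Atoms are first-order atoms $P(\bar t)$ with $P$ a free predicate, or linear arithmetic atoms $s \triangleleft t$ with $\triangleleft \in \{\le,<,\ne,=,>,\ge\}$. A clause is written $\Lambda \parallel C$, where $\Lambda$ is a finite multiset of arithmetic atoms and $C$ a disjunction of free first-order literals; it stands for $(\bigwedge\Lambda) \to C$ with all variables universally quantified. Interpretations interpret arithmetic symbols as in the standard model of the reals and free predicates arbitrarily. A fact is a ground positive unit clause $P(\bar a)$. A free predicate $P$ is positively grounded in $N$ if all positive occurrences of $P$ in $N$ are in facts. For such $P$, $\mathrm{elim}(P,N)$ is the clause set obtained from $N$ by resolving away (by hierarchic resolution: from $\Lambda_1\parallel L\lor C_1$ and $\Lambda_2\parallel K\lor C_2$ with $\sigma$ the most general unifier of $L$ and the complement of $K$, derive $(\Lambda_1,\Lambda_2\parallel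 C_1\lor C_2)\sigma$) all negative occurrences of $P$ against the $P$-facts of $N$ and then deleting all clauses in which $P$ occurs negatively; the $P$-facts themselves are kept; arithmetic atoms are simplified so that they contain at most one integer, and atoms that can be evaluated are replaced by true/false with the clause simplified accordingly. $\mathrm{elim}(S,N)$ extends this to a set $S$ of positively grounded predicates. -}

module Defs where

open import Level using (Level)
open import Data.Nat as ℕ using (ℕ; zero; suc)
open import Data.Integer as ℤ using (ℤ; +_; -[1+_])
open import Data.List using (List; []; _∷_; map; concatMap)
open import Data.List.Relation.Unary.All using (All)
open import Data.List.Relation.Unary.Any using (Any)
open import Data.List.Membership.Propositional using (_∈_)
open import Data.Maybe using (Maybe; just; nothing)
open import Data.Product using (Σ; ∃; _×_; _,_)
open import Data.Sum using (_⊎_)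
open import Data.Bool using (Bool; true; false; if_then_else_; _∨_)
open import Relation.Nullary using (¬_; yes; no)
open import Relation.Nullary.Decidable using (⌊_⌋)
open import Relation.Binary.PropositionalEquality using (_≡_; _≢_)
open import Algebra.Structures using (IsCommutativeRing)
open import Relation.Binary.Structures using (IsStrictTotalOrder)

-- The reals, axiomatised as a Dedekind-complete ordered field
-- (agda-stdlib has no real numbers; every model is isomorphic to ℝ).

record Reals : Set₁ where
  infixl 6 _+_
  infixl 7 _*_
  infix 4 _<_
  field
    ℝ     : Set
    0r 1r : ℝ
    _+_ _*_ : ℝ → ℝ → ℝ
    -_    : ℝ → ℝ
    _<_   : ℝ → ℝ → Set
    isCommutativeRing : IsCommutativeRing _≡_ _+_ _*_ -_ 0r 1r
    0≢1   : 0r ≢ 1r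
    inverse : ∀ x → x ≢ 0r → ∃ λ y → x * y ≡ 1r
    isStrictTotalOrder : IsStrictTotalOrder _≡_ _<_
    +-mono-< : ∀ {x y} z → x < y → x + z < y + z
    *-pos    : ∀ {x y} → 0r < x → 0r < y → 0r < x * y

  infix 4 _≤_
  _≤_ : ℝ → ℝ → Set
  x ≤ y = x < y ⊎ x ≡ y

  _-_ : ℝ → ℝ → ℝ
  x - y = x + (- y)

  field
    complete : (X : ℝ → Set) → (∃ λ x → X x) → (∃ λ b → ∀ x → X x → x ≤ b) →
               ∃ λ s → (∀ x → X x → x ≤ s) × (∀ b → (∀ x → X x → x ≤ b) → s ≤ b)

  fromℕ : ℕ → ℝ
  fromℕ zero    = 0r
  fromℕ (suc n) = fromℕ n + 1r

  fromℤ : ℤ → ℝ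
  fromℤ (+ n)      = fromℕ n
  fromℤ -[1+ n ]   = - (fromℕ (suc n))

data ATerm : Set where
  var  : ℕ → ATerm
  cst  : ℕ → ATerm
  int  : ℤ → ATerm
  _⊕_  : ATerm → ATerm → ATerm
  _⊖_  : ATerm → ATerm → ATerm

data Rel : Set where
  le lt ne eq gt ge : Rel

record AAtom : Set where
  constructor atom
  field
    lhs : ATerm
    rel : Rel
    rhs : ATerm

data Arg : Set where
  var : ℕ → Arg
  num : ℤ → Arg

data Lit : Set where
  pos : ℕ → List Arg → Lit
  neg : ℕ → List Arg → Lit

record Clause : Set where
  constructor _∥_
  field
    Λ : List AAtom
    C : List Lit
open Clause public

fact : ℕ → List ℤ → Clause
fact P zs = [] ∥ (pos P (map num zs) ∷ [])

PosGrounded : List Clause → ℕ → Set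
PosGrounded N P = ∀ {c} → c ∈ N → ∀ {as} → pos P as ∈ C c →
                  ∃ λ zs → c ≡ fact P zs

Subst : Set
Subst = List (ℕ × ℤ)

lookupσ : Subst → ℕ → Maybe ℤ
lookupσ [] x = nothing
lookupσ ((y , z) ∷ σ) x = if ⌊ x ℕ.≟ y ⌋ then just z else lookupσ σ x

unify : Subst → List Arg → List ℤ → Maybe Subst
unify σ [] [] = just σ
unify σ (num a ∷ as) (z ∷ zs) = if ⌊ a ℤ.≟ z ⌋ then unify σ as zs else nothing
unify σ (var x ∷ as) (z ∷ zs) with lookupσ σ x
... | just z' = if ⌊ z' ℤ.≟ z ⌋ then unify σ as zs else nothing
... | nothing = unify ((x , z) ∷ σ) as zs
unify σ _ _ = nothing

substT : Subst → ATerm → ATerm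
substT σ (var x) with lookupσ σ x
... | just z  = int z
... | nothing = var x
substT σ (cst c) = cst c
substT σ (int z) = int z
substT σ (s ⊕ t) = substT σ s ⊕ substT σ t
substT σ (s ⊖ t) = substT σ s ⊖ substT σ t

substAt : Subst → AAtom → AAtom
substAt σ (atom s r t) = atom (substT σ s) r (substT σ t)

substArg : Subst → Arg → Arg
substArg σ (var x) with lookupσ σ x
... | just z  = num z
... | nothing = var x
substArg σ (num z) = num z

substLit : Subst → Lit → Lit
substLit σ (pos Q as) = pos Q (map (substArg σ) as)
substLit σ (neg Q as) = neg Q (map (substArg σ) as)

allNum : List Arg → Maybe (List ℤ)
allNum [] = just []
allNum (num z ∷ as) with allNum as
... | just zs = just (z ∷ zs)
... | nothing = nothing
allNum (var _ ∷ _) = nothing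

factsOf : ℕ → List Clause → List (List ℤ)
factsOf P [] = []
factsOf P (([] ∥ (pos Q as ∷ [])) ∷ N) with P ℕ.≟ Q | allNum as
... | yes _ | just zs = zs ∷ factsOf P N
... | _     | _       = factsOf P N
factsOf P (_ ∷ N) = factsOf P N

resolveAll : List (List ℤ) → ℕ → Subst → List Lit → List Subst
resolveAll fs P σ [] = σ ∷ []
resolveAll fs P σ (pos _ _ ∷ L) = resolveAll fs P σ L
resolveAll fs P σ (neg Q as ∷ L) with P ℕ.≟ Q
... | no _  = resolveAll fs P σ L
... | yes _ = concatMap (λ zs → go (unify σ as zs)) fs
  where
  go : Maybe Subst → List Subst
  go (just σ') = resolveAll fs P σ' L
  go nothing   = []

isNegP : ℕ → Lit → Bool
isNegP P (neg Q _) = ⌊ P ℕ.≟ Q ⌋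
isNegP P (pos _ _) = false

hasNegP : ℕ → List Lit → Bool
hasNegP P [] = false
hasNegP P (l ∷ L) = isNegP P l ∨ hasNegP P L

dropNegP : ℕ → List Lit → List Lit
dropNegP P [] = []
dropNegP P (l ∷ L) = if isNegP P l then dropNegP P L else l ∷ dropNegP P L

elimClause : List (List ℤ) → ℕ → Clause → List Clause
elimClause fs P (Λ ∥ C) =
  if hasNegP P C
  then map (λ σ → map (substAt σ) Λ ∥ map (substLit σ) (dropNegP P C))
           (resolveAll fs P [] C)
  else (Λ ∥ C) ∷ []

elim : ℕ → List Clause → List Clause
elim P N = concatMap (elimClause (factsOf P N) P) N

elimSet : List ℕ → List Clause → List Clause
elimSet [] N = N
elimSet (P ∷ S) N = elim P (elimSet S N)

module _ (R : Reals) where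
  open Reals R

  record Interp : Set₁ where
    field
      constᴵ : ℕ → ℝ
      predᴵ  : ℕ → List ℝ → Set
  open Interp public

  evalT : Interp → (ℕ → ℝ) → ATerm → ℝ
  evalT A β (var x) = β x
  evalT A β (cst c) = constᴵ A c
  evalT A β (int z) = fromℤ z
  evalT A β (s ⊕ t) = evalT A β s + evalT A β t
  evalT A β (s ⊖ t) = evalT A β s - evalT A β t

  holdsRel : Rel → ℝ → ℝ → Set
  holdsRel le x y = x ≤ y
  holdsRel lt x y = x < y
  holdsRel ne x y = ¬ (x ≡ y)
  holdsRel eq x y = x ≡ y
  holdsRel gt x y = y < x
  holdsRel ge x y = y ≤ x

  holdsA : Interp → (ℕ → ℝ) → AAtom → Set
  holdsA A β (atom s r t) = holdsRel r (evalT A β s) (evalT A β t)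

  evalArg : (ℕ → ℝ) → Arg → ℝ
  evalArg β (var x) = β x
  evalArg β (num z) = fromℤ z

  holdsL : Interp → (ℕ → ℝ) → Lit → Set
  holdsL A β (pos P as) = predᴵ A P (map (evalArg β) as)
  holdsL A β (neg P as) = ¬ predᴵ A P (map (evalArg β) as)

  SatClause : Interp → Clause → Set
  SatClause A (Λ ∥ C) = (β : ℕ → ℝ) → All (holdsA A β) Λ → Any (holdsL A β) C

  Sat : Interp → List Clause → Set
  Sat A N = ∀ {c} → c ∈ N → SatClause A c

  modify : List ℕ → List Clause → Interp → Interp
  modify S N A = record
    { constᴵ = constᴵ A
    ; predᴵ  = λ P ā → (P ∈ S × ∃ λ zs → fact P zs ∈ N × map fromℤ zs ≡ ā)
                      ⊎ (¬ (P ∈ S) × predᴵ A P ā)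
    }

-- Eliminating other predicates neither adds nor removes P-facts
-- and keeps P positively grounded, so it suffices to eliminate one predicate P
-- from M with A ⊨ elim(P, M). Given a clause Λ ∥ C of M and an assignment β
-- satisfying Λ: if some ¬P(ā) in C has β(ā) outside the P-facts, that literal
-- holds in A′. Otherwise every such instance matches a fact, so the unifiers
-- exist and β satisfies a resolvent of C in elim(P, M). Its literal true in A
-- is a literal of C other than ¬P(…), and such literals keep their truth
-- value in A′: a positive P-literal can only occur in a fact of M.

module Submission where

open import Defs
open import Data.Nat using (ℕ)
open import Data.List using (List)
open import Data.List.Relation.Unary.All using (All)

import Data.Nat as ℕ
import Data.Nat.Properties as ℕ
open import Data.Integer as ℤ using (ℤ; +_; -[1+_])
open import Data.Bool using (true; false)
open import Data.List using ([]; _∷_; map)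
import Data.List.Properties as List
open import Data.List.Relation.Unary.All using ([]; _∷_)
import Data.List.Relation.Unary.All as All
import Data.List.Relation.Unary.All.Properties as All
open import Data.List.Relation.Unary.Any using (Any; here; there)
import Data.List.Relation.Unary.Any as Any
import Data.List.Relation.Unary.Any.Properties as Any
open import Data.List.Membership.Propositional using (_∈_; _∉_; find; lose)
open import Data.List.Membership.DecPropositional using (_∈?_)
open import Data.List.Membership.Propositional.Properties
  using (∈-map⁺; ∈-map⁻; ∈-concatMap⁺; ∈-concatMap⁻)
open import Data.Maybe using (just; nothing)
open import Data.Product using (∃; _×_; _,_; proj₁)
open import Data.Sum using (_⊎_; inj₁; inj₂; map₁; [_,_]′)
open import Data.Empty using (⊥-elim)
open import Function using (_∘_; id; _⇔_; mk⇔; Equivalence)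
open import Relation.Nullary using (yes; no)
open import Relation.Binary.Definitions using (tri<; tri≈; tri>)
open import Relation.Binary.Structures using (IsStrictTotalOrder)
open import Algebra.Bundles using (CommutativeRing)
import Algebra.Properties.Ring as RingProperties
open import Relation.Binary.PropositionalEquality
  using (_≡_; _≢_; refl; sym; trans; cong; cong₂; subst; subst₂; module ≡-Reasoning)

allNum-map-num : ∀ zs → allNum (map num zs) ≡ just zs
allNum-map-num [] = refl
allNum-map-num (z ∷ zs) rewrite allNum-map-num zs = refl

factsOf-∷ : ∀ P c M {zs} → zs ∈ factsOf P M → zs ∈ factsOf P (c ∷ M)
factsOf-∷ P ([] ∥ (pos Q as ∷ [])) M m with P ℕ.≟ Q | allNum as
... | yes _ | just _  = there m
... | yes _ | nothing = m
... | no _  | _       = m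
factsOf-∷ P ([] ∥ [])                  M m = m
factsOf-∷ P ([] ∥ (pos _ _ ∷ _ ∷ _))  M m = m
factsOf-∷ P ([] ∥ (neg _ _ ∷ _))      M m = m
factsOf-∷ P ((_ ∷ _) ∥ _)              M m = m

fact∈⇒∈factsOf : ∀ {P zs} M → fact P zs ∈ M → zs ∈ factsOf P M
fact∈⇒∈factsOf {P} {zs} (_ ∷ M) (here refl) with P ℕ.≟ P | allNum (map num zs) | allNum-map-num zs
... | yes _   | just _ | refl = here refl
... | no P≢P  | _      | _    = ⊥-elim (P≢P refl)
fact∈⇒∈factsOf (c ∷ M) (there m) = factsOf-∷ _ c M (fact∈⇒∈factsOf M m)

isNegP≡false⇒≢ : ∀ P Q {as} → isNegP P (neg Q as) ≡ false → P ≢ Q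
isNegP≡false⇒≢ P Q e refl with P ℕ.≟ P
... | no P≢P = P≢P refl
isNegP≡false⇒≢ P Q () refl | yes _

hasNegP≡false⇒isNegP≡false : ∀ P C {l} → hasNegP P C ≡ false → l ∈ C → isNegP P l ≡ false
hasNegP≡false⇒isNegP≡false P (k ∷ C) e (here refl) with isNegP P k
... | false = refl
hasNegP≡false⇒isNegP≡false P (k ∷ C) e (there m) with isNegP P k
... | false = hasNegP≡false⇒isNegP≡false P C e m

∈-dropNegP⁻ : ∀ P C {l} → l ∈ dropNegP P C → l ∈ C × isNegP P l ≡ false
∈-dropNegP⁻ P (k ∷ C) m with isNegP P k in eq
... | true = let k∈ , ¬neg = ∈-dropNegP⁻ P C m in there k∈ , ¬neg
∈-dropNegP⁻ P (k ∷ C) (here refl) | false = here refl , eq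
∈-dropNegP⁻ P (k ∷ C) (there m)   | false = let k∈ , ¬neg = ∈-dropNegP⁻ P C m in there k∈ , ¬neg

resolvent : ℕ → Clause → Subst → Clause
resolvent P (Λ ∥ C) σ = map (substAt σ) Λ ∥ map (substLit σ) (dropNegP P C)

∈-elim-kept : ∀ {P M c} → c ∈ M → hasNegP P (C c) ≡ false → c ∈ elim P M
∈-elim-kept {P} {M} {Λ ∥ C} c∈ noNegP = ∈-concatMap⁺ _ (lose c∈ kept)
  where
  kept : (Λ ∥ C) ∈ elimClause (factsOf P M) P (Λ ∥ C)
  kept rewrite noNegP = here refl

∈-elim-resolvent : ∀ {P M c σ} → c ∈ M → hasNegP P (C c) ≡ true →
                   σ ∈ resolveAll (factsOf P M) P [] (C c) → resolvent P c σ ∈ elim P M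
∈-elim-resolvent {P} {M} {Λ ∥ C} {σ} c∈ negP σ∈ = ∈-concatMap⁺ _ (lose c∈ resolved)
  where
  resolved : resolvent P (Λ ∥ C) σ ∈ elimClause (factsOf P M) P (Λ ∥ C)
  resolved rewrite negP = ∈-map⁺ (resolvent P (Λ ∥ C)) σ∈

posLit-elimClause : ∀ {fs Q c d P as} → d ∈ elimClause fs Q c → pos P as ∈ C d →
                    d ≡ c ⊎ (hasNegP Q (C c) ≡ true × ∃ λ bs → pos P bs ∈ C c)
posLit-elimClause {Q = Q} {c = Λ ∥ C} d∈ p∈ with hasNegP Q C
... | false with d∈
...   | here refl = inj₁ refl
posLit-elimClause {Q = Q} {c = Λ ∥ C} d∈ p∈ | true with ∈-map⁻ (resolvent Q (Λ ∥ C)) d∈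
... | σ , _ , refl with ∈-map⁻ (substLit σ) p∈
...   | pos _ bs , l∈ , refl = inj₂ (refl , bs , proj₁ (∈-dropNegP⁻ Q C l∈))

-- Positive literals of elim Q M come from clauses of M; if the predicate is
-- positively grounded, these clauses are facts, which elim keeps unchanged.
posLit-elim : ∀ {Q M d P as} → PosGrounded M P → d ∈ elim Q M → pos P as ∈ C d → d ∈ M
posLit-elim grounded d∈ p∈ with find (∈-concatMap⁻ _ d∈)
... | c , c∈ , d∈c with posLit-elimClause {c = c} d∈c p∈
...   | inj₁ refl = c∈
...   | inj₂ (negQ , bs , q∈) with grounded c∈ q∈
...     | _ , refl with negQ
...       | ()

posLit-elimSet : ∀ {N P d as} S → PosGrounded N P → d ∈ elimSet S N → pos P as ∈ C d → d ∈ N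
posGrounded-elimSet : ∀ {N P} S → PosGrounded N P → PosGrounded (elimSet S N) P

posLit-elimSet []      grounded d∈ p∈ = d∈
posLit-elimSet (Q ∷ S) grounded d∈ p∈ =
  posLit-elimSet S grounded (posLit-elim (posGrounded-elimSet S grounded) d∈ p∈) p∈

posGrounded-elimSet S grounded c∈ p∈ = grounded (posLit-elimSet S grounded c∈ p∈) p∈

fact-elimSet⁺ : ∀ {N P zs} S → fact P zs ∈ N → fact P zs ∈ elimSet S N
fact-elimSet⁺ []      f∈ = f∈
fact-elimSet⁺ (Q ∷ S) f∈ = ∈-elim-kept (fact-elimSet⁺ S f∈) refl

module _ (ℛ : Reals) where
  open Reals ℛ
  private
    ℝ-ring : CommutativeRing _ _
    ℝ-ring = record { isCommutativeRing = isCommutativeRing }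
  open CommutativeRing ℝ-ring
    using (+-identityˡ; +-identityʳ; +-comm; +-assoc; -‿inverseˡ; -‿inverseʳ)
  open RingProperties (CommutativeRing.ring ℝ-ring)
    using (-1*x≈-x; -‿involutive; -‿injective; +-cancelʳ)
  open IsStrictTotalOrder isStrictTotalOrder
    using (compare; irrefl) renaming (trans to <-trans; _≟_ to _≟ℝ_)
  open ≡-Reasoning

  0<1 : 0r < 1r
  0<1 with compare 0r 1r
  ... | tri< 0<1 _ _ = 0<1
  ... | tri≈ _ 0≡1 _ = ⊥-elim (0≢1 0≡1)
  ... | tri> _ _ 1<0 = ⊥-elim (irrefl refl (<-trans 1<0 0<[-1]*[-1]))
    where
    0<-1 : 0r < - 1r
    0<-1 = subst₂ _<_ (-‿inverseʳ 1r) (+-identityˡ (- 1r)) (+-mono-< (- 1r) 1<0)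
    0<[-1]*[-1] : 0r < 1r
    0<[-1]*[-1] = subst (0r <_) (trans (-1*x≈-x (- 1r)) (-‿involutive 1r)) (*-pos 0<-1 0<-1)

  x<x+1 : ∀ x → x < x + 1r
  x<x+1 x = subst₂ _<_ (+-identityˡ x) (+-comm 1r x) (+-mono-< x 0<1)

  0<fromℕ-suc : ∀ n → 0r < fromℕ (ℕ.suc n)
  0<fromℕ-suc ℕ.zero    = subst (0r <_) (sym (+-identityˡ 1r)) 0<1
  0<fromℕ-suc (ℕ.suc n) = <-trans (0<fromℕ-suc n) (x<x+1 _)

  fromℕ-suc≢0 : ∀ n → fromℕ (ℕ.suc n) ≢ 0r
  fromℕ-suc≢0 n e = irrefl (sym e) (0<fromℕ-suc n)

  fromℕ-homo-+ : ∀ m n → fromℕ (m ℕ.+ n) ≡ fromℕ m + fromℕ n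
  fromℕ-homo-+ m ℕ.zero = begin
    fromℕ (m ℕ.+ 0) ≡⟨ cong fromℕ (ℕ.+-identityʳ m) ⟩
    fromℕ m         ≡⟨ +-identityʳ (fromℕ m) ⟨
    fromℕ m + 0r    ∎
  fromℕ-homo-+ m (ℕ.suc n) = begin
    fromℕ (m ℕ.+ ℕ.suc n)       ≡⟨ cong fromℕ (ℕ.+-suc m n) ⟩
    fromℕ (m ℕ.+ n) + 1r        ≡⟨ cong (_+ 1r) (fromℕ-homo-+ m n) ⟩
    fromℕ m + fromℕ n + 1r      ≡⟨ +-assoc (fromℕ m) (fromℕ n) 1r ⟩
    fromℕ m + (fromℕ n + 1r)    ∎

  fromℕ-injective : ∀ {m n} → fromℕ m ≡ fromℕ n → m ≡ n
  fromℕ-injective {ℕ.zero}  {ℕ.zero}  e = refl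
  fromℕ-injective {ℕ.zero}  {ℕ.suc n} e = ⊥-elim (fromℕ-suc≢0 n (sym e))
  fromℕ-injective {ℕ.suc m} {ℕ.zero}  e = ⊥-elim (fromℕ-suc≢0 m e)
  fromℕ-injective {ℕ.suc m} {ℕ.suc n} e =
    cong ℕ.suc (fromℕ-injective (+-cancelʳ 1r (fromℕ m) (fromℕ n) e))

  fromℕ≢-fromℕ-suc : ∀ m n → fromℕ m ≢ - fromℕ (ℕ.suc n)
  fromℕ≢-fromℕ-suc m n e = fromℕ-suc≢0 (m ℕ.+ n) (begin
    fromℕ (ℕ.suc (m ℕ.+ n))         ≡⟨ cong fromℕ (ℕ.+-suc m n) ⟨
    fromℕ (m ℕ.+ ℕ.suc n)           ≡⟨ fromℕ-homo-+ m (ℕ.suc n) ⟩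
    fromℕ m + p                     ≡⟨ cong (_+ p) e ⟩
    - p + p                         ≡⟨ -‿inverseˡ p ⟩
    0r                              ∎)
    where p = fromℕ (ℕ.suc n)

  fromℤ-injective : ∀ {a b} → fromℤ a ≡ fromℤ b → a ≡ b
  fromℤ-injective {+ m}      {+ n}      e = cong +_ (fromℕ-injective e)
  fromℤ-injective { -[1+ m ]} { -[1+ n ]} e
    with refl ← fromℕ-injective {ℕ.suc m} {ℕ.suc n} (-‿injective e) = refl
  fromℤ-injective {+ m}      { -[1+ n ]} e = ⊥-elim (fromℕ≢-fromℕ-suc m n e)
  fromℤ-injective { -[1+ m ]} {+ n}      e = ⊥-elim (fromℕ≢-fromℕ-suc n m (sym e))

  Agrees : Subst → (ℕ → ℝ) → Set
  Agrees σ β = ∀ {x z} → lookupσ σ x ≡ just z → β x ≡ fromℤ z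

  module _ {σ β} (agrees : Agrees σ β) where

    evalT-substT : ∀ {A} t → evalT ℛ A β (substT σ t) ≡ evalT ℛ A β t
    evalT-substT (var x) with lookupσ σ x in eq
    ... | just z  = sym (agrees eq)
    ... | nothing = refl
    evalT-substT (cst _) = refl
    evalT-substT (int _) = refl
    evalT-substT (s ⊕ t) = cong₂ _+_ (evalT-substT s) (evalT-substT t)
    evalT-substT (s ⊖ t) = cong₂ _-_ (evalT-substT s) (evalT-substT t)

    holdsA-substAt : ∀ {A} a → holdsA ℛ A β a → holdsA ℛ A β (substAt σ a)
    holdsA-substAt (atom s r t) =
      subst₂ (holdsRel ℛ r) (sym (evalT-substT s)) (sym (evalT-substT t))

    evalArg-substArg : ∀ a → evalArg ℛ β (substArg σ a) ≡ evalArg ℛ β a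
    evalArg-substArg (var x) with lookupσ σ x in eq
    ... | just z  = sym (agrees eq)
    ... | nothing = refl
    evalArg-substArg (num z) = refl

    evalArgs-substArg : ∀ as → map (evalArg ℛ β) (map (substArg σ) as) ≡ map (evalArg ℛ β) as
    evalArgs-substArg as = trans (sym (List.map-∘ as)) (List.map-cong evalArg-substArg as)

    holdsL-substLit : ∀ {A} l → holdsL ℛ A β (substLit σ l) → holdsL ℛ A β l
    holdsL-substLit {A} (pos Q as) h = subst (predᴵ A Q) (evalArgs-substArg as) h
    holdsL-substLit {A} (neg Q as) h p = h (subst (predᴵ A Q) (sym (evalArgs-substArg as)) p)

  unify-complete : ∀ {σ β} as zs → Agrees σ β → map fromℤ zs ≡ map (evalArg ℛ β) as →
                   ∃ λ σ' → unify σ as zs ≡ just σ' × Agrees σ' β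
  unify-complete {σ} [] [] agrees _ = σ , refl , agrees
  unify-complete (num a ∷ as) (z ∷ zs) agrees e with List.∷-injective e
  ... | z≡a , e′ with a ℤ.≟ z
  ...   | yes _   = unify-complete as zs agrees e′
  ...   | no a≢z  = ⊥-elim (a≢z (sym (fromℤ-injective z≡a)))
  unify-complete {σ} {β} (var x ∷ as) (z ∷ zs) agrees e with List.∷-injective e
  ... | z≡βx , e′ with lookupσ σ x in eq
  ...   | just z′ with z′ ℤ.≟ z
  ...     | yes _   = unify-complete as zs agrees e′
  ...     | no z′≢z = ⊥-elim (z′≢z (fromℤ-injective (trans (sym (agrees eq)) (sym z≡βx))))
  unify-complete {σ} {β} (var x ∷ as) (z ∷ zs) agrees e | z≡βx , e′ | nothing =
    unify-complete as zs agrees′ e′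
    where
    agrees′ : Agrees ((x , z) ∷ σ) β
    agrees′ {y} eq′ with y ℕ.≟ x
    agrees′ refl | yes refl = sym z≡βx
    ...          | no _     = agrees eq′

  UnmatchedNeg : List (List ℤ) → ℕ → (ℕ → ℝ) → Lit → Set
  UnmatchedNeg fs P β l = ∃ λ as → l ≡ neg P as × map (evalArg ℛ β) as ∉ map (map fromℤ) fs

  resolveAll-complete : ∀ {fs P β} {G : Set} L {σ} → Agrees σ β →
    (∀ {σ'} → σ' ∈ resolveAll fs P σ L → Agrees σ' β → G) →
    Any (UnmatchedNeg fs P β) L ⊎ G
  resolveAll-complete [] agrees k = inj₂ (k (here refl) agrees)
  resolveAll-complete (pos _ _ ∷ L) agrees k = map₁ there (resolveAll-complete L agrees k)
  resolveAll-complete {fs} {P} {β} (neg Q as ∷ L) {σ} agrees k with P ℕ.≟ Q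
  ... | no _ = map₁ there (resolveAll-complete L agrees k)
  ... | yes refl with _∈?_ (List.≡-dec _≟ℝ_) (map (evalArg ℛ β) as) (map (map fromℤ) fs)
  ...   | no unmatched = inj₁ (here (as , refl , unmatched))
  ...   | yes matched with ∈-map⁻ (map fromℤ) matched
  ...     | zs , zs∈ , e with unify-complete {σ} as zs agrees (sym e)
  ...       | σ₁ , unified , agrees₁
  -- unify σ as zs is hidden under the λ of concatMap in resolveAll; it surfaces
  -- in the type of the continuation restricted to the block of the fact zs.
              with unify σ as zs | unified | (λ {σ'} σ'∈ → k {σ'} (∈-concatMap⁺ _ (lose zs∈ σ'∈)))
  ...         | _ | refl | k₁ = map₁ there (resolveAll-complete L agrees₁ k₁)

  evalT-const : ∀ {A B : Interp ℛ} → (∀ c → constᴵ A c ≡ constᴵ B c) →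
                ∀ {β} t → evalT ℛ A β t ≡ evalT ℛ B β t
  evalT-const consts (var _) = refl
  evalT-const consts (cst c) = consts c
  evalT-const consts (int _) = refl
  evalT-const consts (s ⊕ t) = cong₂ _+_ (evalT-const consts s) (evalT-const consts t)
  evalT-const consts (s ⊖ t) = cong₂ _-_ (evalT-const consts s) (evalT-const consts t)

  holdsA-const : ∀ {A B : Interp ℛ} → (∀ c → constᴵ A c ≡ constᴵ B c) →
                 ∀ {β} a → holdsA ℛ A β a → holdsA ℛ B β a
  holdsA-const consts (atom s r t) =
    subst₂ (holdsRel ℛ r) (evalT-const consts s) (evalT-const consts t)

  _≃_ : Interp ℛ → Interp ℛ → Set
  A ≃ B = (∀ c → constᴵ A c ≡ constᴵ B c) × (∀ P ā → predᴵ A P ā ⇔ predᴵ B P ā)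

  Sat-resp-≃ : ∀ {A B N} → A ≃ B → Sat ℛ A N → Sat ℛ B N
  Sat-resp-≃ {A} {B} (consts , preds) satA c∈ β hyps =
    Any.map (λ {l} → holdsL-resp l)
      (satA c∈ β (All.map (λ {a} → holdsA-const (sym ∘ consts) a) hyps))
    where
    holdsL-resp : ∀ l → holdsL ℛ A β l → holdsL ℛ B β l
    holdsL-resp (pos Q as) = Equivalence.to (preds Q _)
    holdsL-resp (neg Q as) ¬a b = ¬a (Equivalence.from (preds Q _) b)

  modify-[] : ∀ {N} A → A ≃ modify ℛ [] N A
  modify-[] A =
    (λ _ → refl) , λ _ _ → mk⇔ (λ a → inj₂ ((λ ()) , a)) [ (λ { (() , _) }) , (λ (_ , a) → a) ]′

  modify-∷ : ∀ {N P A} S → PosGrounded N P →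
             modify ℛ S N (modify ℛ (P ∷ []) (elimSet S N) A) ≃ modify ℛ (P ∷ S) N A
  modify-∷ {N} {P} {A} S grounded = (λ _ → refl) , λ Q ā → mk⇔ (to Q ā) (from Q ā)
    where
    to : ∀ Q ā → predᴵ (modify ℛ S N (modify ℛ (P ∷ []) (elimSet S N) A)) Q ā →
                 predᴵ (modify ℛ (P ∷ S) N A) Q ā
    to Q ā (inj₁ (Q∈S , fact)) = inj₁ (there Q∈S , fact)
    to Q ā (inj₂ (_ , inj₁ (here refl , zs , f∈ , e))) =
      inj₁ (here refl , zs , posLit-elimSet S grounded f∈ (here refl) , e)
    to Q ā (inj₂ (Q∉S , inj₂ (Q∉P , a))) =
      inj₂ ((λ { (here Q≡P) → Q∉P (here Q≡P) ; (there Q∈S) → Q∉S Q∈S }) , a)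
    from : ∀ Q ā → predᴵ (modify ℛ (P ∷ S) N A) Q ā →
                   predᴵ (modify ℛ S N (modify ℛ (P ∷ []) (elimSet S N) A)) Q ā
    from Q ā (inj₁ (here refl , fact)) with _∈?_ ℕ._≟_ Q S
    ... | yes Q∈S = inj₁ (Q∈S , fact)
    ... | no Q∉S  = let zs , f∈ , e = fact in
                    inj₂ (Q∉S , inj₁ (here refl , zs , fact-elimSet⁺ S f∈ , e))
    from Q ā (inj₁ (there Q∈S , fact)) = inj₁ (Q∈S , fact)
    from Q ā (inj₂ (Q∉P∷S , a)) =
      inj₂ (Q∉P∷S ∘ there , inj₂ ((λ { (here Q≡P) → Q∉P∷S (here Q≡P) }) , a))

  holdsL-modify⁺ : ∀ {M P A β c l} → PosGrounded M P → c ∈ M → l ∈ C c →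
                   isNegP P l ≡ false → holdsL ℛ A β l → holdsL ℛ (modify ℛ (P ∷ []) M A) β l
  holdsL-modify⁺ {P = P} {l = pos Q as} grounded c∈ l∈ _ a with Q ℕ.≟ P
  ... | no Q≢P = inj₂ ((λ { (here Q≡P) → Q≢P Q≡P }) , a)
  ... | yes refl with grounded c∈ l∈
  ...   | zs , refl with l∈
  ...     | here refl = inj₁ (here refl , zs , c∈ , List.map-∘ zs)
  holdsL-modify⁺ {P = P} {l = neg Q as} _ _ _ notNegP ¬a (inj₁ (here Q≡P , _)) =
    isNegP≡false⇒≢ P Q {as} notNegP (sym Q≡P)
  holdsL-modify⁺ {l = neg Q as} _ _ _ _ ¬a (inj₂ (_ , a)) = ¬a a

  sat-elim⇒sat-modify : ∀ {M P} → PosGrounded M P → (A : Interp ℛ) →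
                        Sat ℛ A (elim P M) → Sat ℛ (modify ℛ (P ∷ []) M A) M
  sat-elim⇒sat-modify {M} {P} grounded A sat {Λ ∥ C} c∈ β hyps = satisfied
    where
    A′ = modify ℛ (P ∷ []) M A

    hypsA : All (holdsA ℛ A β) Λ
    hypsA = All.map (λ {a} → holdsA-const (λ _ → refl) a) hyps

    lift : ∀ {l} → l ∈ C → isNegP P l ≡ false → holdsL ℛ A β l → holdsL ℛ A′ β l
    lift = holdsL-modify⁺ grounded c∈

    unmatched-holds : ∀ {l} → UnmatchedNeg (factsOf P M) P β l → holdsL ℛ A′ β l
    unmatched-holds (as , refl , unmatched) (inj₁ (_ , zs , f∈ , e)) =
      unmatched (subst (_∈ _) e (∈-map⁺ (map fromℤ) (fact∈⇒∈factsOf M f∈)))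
    unmatched-holds (as , refl , unmatched) (inj₂ (P∉P , _)) = P∉P (here refl)

    satisfied : Any (holdsL ℛ A′ β) C
    satisfied with hasNegP P C in negP
    ... | false = let l , l∈ , h = find (sat (∈-elim-kept c∈ negP) β hypsA) in
                  lose l∈ (lift l∈ (hasNegP≡false⇒isNegP≡false P C negP l∈) h)
    ... | true = [ Any.map unmatched-holds , id ]′ (resolveAll-complete C (λ ()) resolvent-holds)
      where
      resolvent-holds : ∀ {σ} → σ ∈ resolveAll (factsOf P M) P [] C → Agrees σ β →
                        Any (holdsL ℛ A′ β) C
      resolvent-holds σ∈ agrees =
        let hypsσ = All.map⁺ (All.map (λ {a} → holdsA-substAt agrees a) hypsA)
            l , l∈ , h = find (Any.map⁻ (sat (∈-elim-resolvent c∈ negP σ∈) β hypsσ))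
            l∈C , notNegP = ∈-dropNegP⁻ P C l∈
        in lose l∈C (lift l∈C notNegP (holdsL-substLit agrees l h))

lemma1 : (R : Reals) (N : List Clause) (S : List ℕ) →
    All (PosGrounded N) S →
    (A : Interp R) → Sat R A (elimSet S N) →
    Sat R (modify R S N A) N
lemma1 R N [] [] A sat = Sat-resp-≃ R (modify-[] R A) sat
lemma1 R N (P ∷ S) (grounded ∷ groundeds) A sat =
  Sat-resp-≃ R (modify-∷ R S grounded)
    (lemma1 R N S groundeds (modify R (P ∷ []) (elimSet S N) A)
      (sat-elim⇒sat-modify R (posGrounded-elimSet S grounded) A sat))
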